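{- Let $n$ be any integer. Then there is a unique element $\varepsilon\in\Omega(\mathrm{odd})\cup\Omega(\mathrm{even})$ (where the all-zero sequences of odd and even length are identified with each other) such that $\|\varepsilon\|_{\mathrm{sFib}}=n$.
   Context: For $k\ge1$, $\Omega(k)$ is the set of down-up zero-one sequences $(\varepsilon_{k-1},\dots,\varepsilon_0)$ with $\varepsilon_{k-1}\ge\varepsilon_{k-2}\le\varepsilon_{k-3}\ge\cdots\varepsilon_0$; $\Omega(0)$ consists of a single (zero) sequence of value $0$. For each $k$, identify $\Omega(k)$ with its image in $\Omega(k+2)$ under $\varepsilon\mapsto(0,0,\varepsilon)$. $\Omega(\mathrm{even}):=\bigcup_{i\ge0}\Omega(2i)$, $\Omega(\mathrm{odd}):=\bigcup_{i\ge0}\Omega(2i+1)$ under these identifications. The signed Fibonacci numbers are defined for all integers by $\mathrm{Fib}(0)=0,\mathrm{Fib}(1)=1$ and $\mathrm{Fib}(n)=\mathrm{Fib}(n-1)+\mathrm{Fib}(n-2)$ for all $n\in\mathbb{Z}$ (so $\mathrm{Fib}(-m)=(-1)^{m-1}\mathrm{Fib}(m)$). For an integer sequence $V=(v_{k-1},\dots,v_0)$, $\|V\|_{\mathrm{sFib}}:=\sum_{i=0}^{k-1}v_i\,\mathrm{Fib}(-i-2)$. -}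

module Defs where

open import Data.Nat using (ℕ; zero; suc; _*_)
open import Data.Integer as ℤ using (ℤ; +_; -[1+_]; _-_; _+_)
open import Data.Bool using (Bool; true; false; _≤_)
open import Data.List using (List; []; _∷_; length; replicate; _++_)
open import Data.List.Relation.Unary.All using (All)
open import Data.Product using (Σ; _×_; ∃)
open import Data.Sum using (_⊎_)
open import Data.Unit using (⊤)
open import Relation.Binary.PropositionalEquality using (_≡_)

fibℕ : ℕ → ℤ
fibℕ zero = + 0
fibℕ (suc zero) = + 1
fibℕ (suc (suc n)) = fibℕ (suc n) + fibℕ n

-- fibNeg m = Fib(-m), obtained from the recurrence run backwards:
-- Fib(-m-2) = Fib(-m) - Fib(-m-1).
fibNeg : ℕ → ℤ
fibNeg zero = + 0
fibNeg (suc zero) = + 1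
fibNeg (suc (suc m)) = fibNeg m - fibNeg (suc m)

sFib : ℤ → ℤ
sFib (+ n) = fibℕ n
sFib -[1+ m ] = fibNeg (suc m)

-- A 0-1 sequence (ε_{k-1}, …, ε_0) is a list whose head is ε_{k-1}.
-- false = 0, true = 1.
bit : Bool → ℤ
bit false = + 0
bit true = + 1

sFibNorm : List Bool → ℤ
sFibNorm [] = + 0
sFibNorm (v ∷ vs) = bit v ℤ.* sFib (ℤ.- (+ suc (suc (length vs)))) + sFibNorm vs

mutual
  DownUp : List Bool → Set
  DownUp [] = ⊤
  DownUp (x ∷ []) = ⊤
  DownUp (x ∷ y ∷ r) = (y ≤ x) × UpDown (y ∷ r)

  UpDown : List Bool → Set
  UpDown [] = ⊤
  UpDown (x ∷ []) = ⊤
  UpDown (x ∷ y ∷ r) = (x ≤ y) × DownUp (y ∷ r)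

Ω : ℕ → Set
Ω k = Σ (List Bool) (λ ε → length ε ≡ k × DownUp ε)

AllZero : List Bool → Set
AllZero = All (_≡ false)

-- The identifications in Ω(odd) ∪ Ω(even): ε ∈ Ω(k) is identified with
-- (0,0,ε) ∈ Ω(k+2) (hence with 0^{2j}ε), and all-zero sequences of any
-- length are identified with each other.
Identified : List Bool → List Bool → Set
Identified ε ε' =
  (AllZero ε × AllZero ε')
  ⊎ (∃ λ j → ε' ≡ replicate (2 * j) false ++ ε)
  ⊎ (∃ λ j → ε ≡ replicate (2 * j) false ++ ε')

-- Since Fib(-i-2) = (-1)^(i+1) Fib(i+2), the sFib-norm of a down-up word of length N is
-- (-1)^N times a natural number, its rank.  By its leading pair 00, 11 or 10 the rank of
-- such a word lies in [0, Fib N), [Fib N, Fib(N+1)) or [Fib(N+1), Fib(N+2)), so the greedy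
-- algorithm inverts rank, a bijection onto [0, Fib(N+2)).  Hence every integer is the norm of
-- a word of each long enough length of the right parity.  Two solutions of equal length
-- coincide; of lengths of equal parity they differ by leading 00 pairs; of lengths of
-- different parity both have rank 0 and are therefore all-zero.
module Submission where

open import Defs
open import Data.Bool using (Bool; true; false; b≤b; f≤t)
open import Data.Integer as ℤ using (ℤ; _◃_; ∣_∣; sign)
open import Data.Integer.Properties
  using (◃-distrib-+; ◃-inverse; abs-cong; sign-cong′; neg-involutive; neg-distrib-+)
  renaming (+-identityˡ to ℤ+-identityˡ; *-identityˡ to ℤ*-identityˡ)
open import Data.Integer.Tactic.RingSolver using (solve-∀)
open import Data.List using (List; []; _∷_; length; replicate; _++_)
open import Data.List.Properties using (length-++; length-replicate)
open import Data.List.Relation.Unary.All using ([]; _∷_)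
open import Data.Nat
  using (ℕ; zero; suc; _+_; _*_; _∸_; _≤_; _<_; z≤n; s≤s; _≤?_; parity; >-nonZero)
open import Data.Nat.Properties
  using ( ≤-refl; ≤-trans; <-≤-trans; ≤-reflexive; ≤-total; ≰⇒>; >⇒≢; <⇒≱; m≤m+n
        ; +-comm; +-suc; *-suc; +-mono-≤; +-monoʳ-≤; +-monoʳ-<; m+n≡0⇒m≡0
        ; m+n∸m≡n; m+[n∸m]≡n; m<n+o⇒m∸n<o; m+n≤o⇒m≤o∸n)
open import Data.Parity.Base using (0ℙ; 1ℙ; toSign; fromSign)
open import Data.Parity.Properties using (toSign-injective; toSign-inverseˡ)
open import Data.Product using (Σ; _×_; _,_; proj₁; proj₂; ∃-syntax)
open import Data.Sum using (inj₁; inj₂)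
open import Data.Unit using (tt)
open import Relation.Nullary using (yes; no; does; contradiction)
open import Relation.Binary.PropositionalEquality
  using (_≡_; refl; sym; trans; cong; cong₂; subst; module ≡-Reasoning)

fib : ℕ → ℕ
fib zero = 0
fib (suc zero) = 1
fib (suc (suc n)) = fib (suc n) + fib n

fib-pos : ∀ n → 0 < fib (suc n)
fib-pos zero = s≤s z≤n
fib-pos (suc n) = ≤-trans (fib-pos n) (m≤m+n (fib (suc n)) (fib n))

UpDown-∷⁻ : ∀ b r → UpDown (b ∷ r) → DownUp r
UpDown-∷⁻ _ [] _ = tt
UpDown-∷⁻ _ (_ ∷ _) (_ , d) = d

UpDown-false∷⁺ : ∀ r → DownUp r → UpDown (false ∷ r)
UpDown-false∷⁺ [] _ = tt
UpDown-false∷⁺ (false ∷ _) d = b≤b , d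
UpDown-false∷⁺ (true ∷ _) d = f≤t , d

-- Read from the top, a down-up word is a sequence of pairs 00, 10, 11 (never 01), plus one
-- letter if its length is odd.  Above a tail of length L a pair has weights
-- ±(Fib(L+3), -Fib(L+2)), so 10 and 11 contribute ±Fib(L+3) and ±Fib(L+1).
pairWeight : Bool → Bool → ℕ → ℕ
pairWeight false _ L = 0
pairWeight true false L = fib (3 + L)
pairWeight true true L = fib (1 + L)

rank : List Bool → ℕ
rank [] = 0
rank (x ∷ y ∷ r) = pairWeight x y (length r) + rank r
rank (false ∷ []) = 0
rank (true ∷ []) = 1

-- Greedy inverse of rank on down-up words of length L; junk unless a < fib (2 + L).
decode : ℕ → ℕ → List Bool
decode zero a = []
decode (suc zero) a = does (1 ≤? a) ∷ []
decode (suc (suc L)) a with fib (3 + L) ≤? a | fib (2 + L) ≤? a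
... | yes _ | _ = true ∷ false ∷ decode L (a ∸ fib (3 + L))
... | no _ | yes _ = true ∷ true ∷ decode L (a ∸ fib (1 + L))
... | no _ | no _ = false ∷ false ∷ decode L a

fibNeg-◃ : ∀ L → fibNeg (1 + L) ≡ toSign (parity L) ◃ fib (1 + L)
               × fibNeg (2 + L) ≡ ℤ.- (toSign (parity L) ◃ fib (2 + L))
fibNeg-◃ zero = refl , refl
fibNeg-◃ (suc zero) = refl , refl
fibNeg-◃ (suc (suc L)) = odd , even
  where
  open ≡-Reasoning
  s = toSign (parity L)
  F₁ = fib (1 + L)
  F₂ = fib (2 + L)
  F₃ = fib (3 + L)
  odd : fibNeg (3 + L) ≡ s ◃ F₃
  odd = begin
    fibNeg (1 + L) ℤ.- fibNeg (2 + L)     ≡⟨ cong₂ ℤ._-_ (proj₁ (fibNeg-◃ L)) (proj₂ (fibNeg-◃ L)) ⟩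
    (s ◃ F₁) ℤ.+ ℤ.- ℤ.- (s ◃ F₂)        ≡⟨ cong (ℤ._+_ (s ◃ F₁)) (neg-involutive (s ◃ F₂)) ⟩
    (s ◃ F₁) ℤ.+ (s ◃ F₂)                ≡⟨ ◃-distrib-+ s F₁ F₂ ⟨
    s ◃ (F₁ + F₂)                        ≡⟨ cong (s ◃_) (+-comm F₁ F₂) ⟩
    s ◃ F₃                               ∎
  even : fibNeg (4 + L) ≡ ℤ.- (s ◃ fib (4 + L))
  even = begin
    fibNeg (2 + L) ℤ.- fibNeg (3 + L)     ≡⟨ cong₂ ℤ._-_ (proj₂ (fibNeg-◃ L)) odd ⟩
    ℤ.- (s ◃ F₂) ℤ.- (s ◃ F₃)            ≡⟨ neg-distrib-+ (s ◃ F₂) (s ◃ F₃) ⟨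
    ℤ.- ((s ◃ F₂) ℤ.+ (s ◃ F₃))          ≡⟨ cong ℤ.-_ (◃-distrib-+ s F₂ F₃) ⟨
    ℤ.- (s ◃ (F₂ + F₃))                  ≡⟨ cong (λ n → ℤ.- (s ◃ n)) (+-comm F₂ F₃) ⟩
    ℤ.- (s ◃ fib (4 + L))                ∎

sFibNorm-pair : ∀ {x y r} → DownUp (x ∷ y ∷ r) →
  sFibNorm (x ∷ y ∷ r) ≡ (toSign (parity (length r)) ◃ pairWeight x y (length r)) ℤ.+ sFibNorm r
sFibNorm-pair {false} {false} {r} _ = ℤ+-identityˡ (ℤ.+ 0 ℤ.+ sFibNorm r)
sFibNorm-pair {false} {true} (() , _)
sFibNorm-pair {true} {false} {r} _ = begin
  ℤ.+ 1 ℤ.* fibNeg (3 + L) ℤ.+ (ℤ.+ 0 ℤ.* fibNeg (2 + L) ℤ.+ sFibNorm r)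
    ≡⟨ cong₂ ℤ._+_ (ℤ*-identityˡ (fibNeg (3 + L))) (ℤ+-identityˡ (sFibNorm r)) ⟩
  fibNeg (3 + L) ℤ.+ sFibNorm r
    ≡⟨ cong (ℤ._+ sFibNorm r) (proj₁ (fibNeg-◃ (2 + L))) ⟩
  (s ◃ fib (3 + L)) ℤ.+ sFibNorm r ∎
  where
  open ≡-Reasoning
  L = length r
  s = toSign (parity L)
sFibNorm-pair {true} {true} {r} _ = begin
  ℤ.+ 1 ℤ.* fibNeg (3 + L) ℤ.+ (ℤ.+ 1 ℤ.* fibNeg (2 + L) ℤ.+ sFibNorm r)
    ≡⟨ cong₂ (λ u v → u ℤ.+ (v ℤ.+ sFibNorm r)) (ℤ*-identityˡ (fibNeg (3 + L)))
                                                   (ℤ*-identityˡ (fibNeg (2 + L))) ⟩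
  fibNeg (3 + L) ℤ.+ (fibNeg (2 + L) ℤ.+ sFibNorm r)
    ≡⟨ cong₂ (λ u v → u ℤ.+ (v ℤ.+ sFibNorm r)) (proj₁ (fibNeg-◃ (2 + L)))
                                                   (proj₂ (fibNeg-◃ L)) ⟩
  (s ◃ (F₂ + F₁)) ℤ.+ (ℤ.- (s ◃ F₂) ℤ.+ sFibNorm r)
    ≡⟨ cong (ℤ._+ (ℤ.- (s ◃ F₂) ℤ.+ sFibNorm r)) (◃-distrib-+ s F₂ F₁) ⟩
  ((s ◃ F₂) ℤ.+ (s ◃ F₁)) ℤ.+ (ℤ.- (s ◃ F₂) ℤ.+ sFibNorm r)
    ≡⟨ cancel (s ◃ F₂) (s ◃ F₁) (sFibNorm r) ⟩
  (s ◃ F₁) ℤ.+ sFibNorm r ∎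
  where
  open ≡-Reasoning
  L = length r
  s = toSign (parity L)
  F₁ = fib (1 + L)
  F₂ = fib (2 + L)
  cancel : ∀ a b c → (a ℤ.+ b) ℤ.+ (ℤ.- a ℤ.+ c) ≡ b ℤ.+ c
  cancel = solve-∀

sFibNorm-rank : ∀ {ε} → DownUp ε → sFibNorm ε ≡ toSign (parity (length ε)) ◃ rank ε
sFibNorm-rank {[]} _ = refl
sFibNorm-rank {false ∷ []} _ = refl
sFibNorm-rank {true ∷ []} _ = refl
sFibNorm-rank {x ∷ y ∷ r} d@(_ , u) = begin
  sFibNorm (x ∷ y ∷ r)        ≡⟨ sFibNorm-pair d ⟩
  (s ◃ w) ℤ.+ sFibNorm r      ≡⟨ cong (ℤ._+_ (s ◃ w)) (sFibNorm-rank (UpDown-∷⁻ y r u)) ⟩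
  (s ◃ w) ℤ.+ (s ◃ rank r)    ≡⟨ ◃-distrib-+ s w (rank r) ⟨
  s ◃ rank (x ∷ y ∷ r)        ∎
  where
  open ≡-Reasoning
  s = toSign (parity (length r))
  w = pairWeight x y (length r)

rank-≥ : ∀ {ε} → UpDown (true ∷ ε) → fib (length ε) ≤ rank ε
rank-≥ {[]} _ = z≤n
rank-≥ {true ∷ []} _ = ≤-refl
rank-≥ {false ∷ []} (() , _)
rank-≥ {false ∷ _ ∷ _} (() , _)
rank-≥ {true ∷ false ∷ r} _ =
  ≤-trans (m≤m+n (fib (2 + length r)) (fib (1 + length r))) (m≤m+n (fib (3 + length r)) (rank r))
rank-≥ {true ∷ true ∷ r} (_ , _ , u) = +-monoʳ-≤ (fib (1 + length r)) (rank-≥ u)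

rank-< : ∀ {ε} → DownUp ε → rank ε < fib (2 + length ε)
rank-< {[]} _ = s≤s z≤n
rank-< {false ∷ []} _ = s≤s z≤n
rank-< {true ∷ []} _ = s≤s (s≤s z≤n)
rank-< {false ∷ false ∷ r} (_ , u) =
  <-≤-trans (rank-< (UpDown-∷⁻ false r u)) (≤-trans (m≤m+n F₂ F₁) (m≤m+n F₃ F₂))
  where
  F₁ = fib (1 + length r)
  F₂ = fib (2 + length r)
  F₃ = fib (3 + length r)
rank-< {false ∷ true ∷ r} (() , _)
rank-< {true ∷ false ∷ r} (_ , u) = +-monoʳ-< (fib (3 + length r)) (rank-< (UpDown-∷⁻ false r u))
rank-< {true ∷ true ∷ r} (_ , u) =
  <-≤-trans (+-monoʳ-< F₁ (rank-< (UpDown-∷⁻ true r u)))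
            (≤-trans (≤-reflexive (+-comm F₁ F₂)) (m≤m+n F₃ F₂))
  where
  F₁ = fib (1 + length r)
  F₂ = fib (2 + length r)
  F₃ = fib (3 + length r)

decode-00 : ∀ {L a} → a < fib (2 + L) → decode (2 + L) a ≡ false ∷ false ∷ decode L a
decode-00 {L} {a} a<F₂ with fib (3 + L) ≤? a | fib (2 + L) ≤? a
... | yes F₃≤a | _ = contradiction (≤-trans (m≤m+n _ (fib (1 + L))) F₃≤a) (<⇒≱ a<F₂)
... | no _ | yes F₂≤a = contradiction F₂≤a (<⇒≱ a<F₂)
... | no _ | no _ = refl

decode-11 : ∀ {L a} → fib (2 + L) ≤ a → a < fib (3 + L) →
            decode (2 + L) a ≡ true ∷ true ∷ decode L (a ∸ fib (1 + L))
decode-11 {L} {a} F₂≤a a<F₃ with fib (3 + L) ≤? a | fib (2 + L) ≤? a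
... | yes F₃≤a | _ = contradiction F₃≤a (<⇒≱ a<F₃)
... | no _ | yes _ = refl
... | no _ | no F₂≰a = contradiction F₂≤a F₂≰a

decode-10 : ∀ {L a} → fib (3 + L) ≤ a → decode (2 + L) a ≡ true ∷ false ∷ decode L (a ∸ fib (3 + L))
decode-10 {L} {a} F₃≤a with fib (3 + L) ≤? a
... | yes _ = refl
... | no F₃≰a = contradiction F₃≤a F₃≰a

decode-rank : ∀ {ε} → DownUp ε → decode (length ε) (rank ε) ≡ ε
decode-rank {[]} _ = refl
decode-rank {false ∷ []} _ = refl
decode-rank {true ∷ []} _ = refl
decode-rank {false ∷ true ∷ r} (() , _)
decode-rank {false ∷ false ∷ r} (_ , u) =
  trans (decode-00 (rank-< d)) (cong (λ t → false ∷ false ∷ t) (decode-rank d))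
  where d = UpDown-∷⁻ false r u
decode-rank {true ∷ false ∷ r} (_ , u) =
  trans (decode-10 (m≤m+n F₃ (rank r)))
        (cong (λ t → true ∷ false ∷ t)
              (trans (cong (decode (length r)) (m+n∸m≡n F₃ (rank r))) (decode-rank d)))
  where
  d = UpDown-∷⁻ false r u
  F₃ = fib (3 + length r)
decode-rank {true ∷ true ∷ r} (_ , u) =
  trans (decode-11 (+-monoʳ-≤ F₁ (rank-≥ u))
                   (<-≤-trans (+-monoʳ-< F₁ (rank-< d)) (≤-reflexive (+-comm F₁ _))))
        (cong (λ t → true ∷ true ∷ t)
              (trans (cong (decode (length r)) (m+n∸m≡n F₁ (rank r))) (decode-rank d)))
  where
  d = UpDown-∷⁻ true r u
  F₁ = fib (1 + length r)

rank-injective : ∀ {ε ε'} → DownUp ε → DownUp ε' → length ε ≡ length ε' → rank ε ≡ rank ε' → ε ≡ ε'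
rank-injective {ε} {ε'} d d' eqL eqR = begin
  ε                            ≡⟨ decode-rank d ⟨
  decode (length ε) (rank ε)   ≡⟨ cong₂ decode eqL eqR ⟩
  decode (length ε') (rank ε') ≡⟨ decode-rank d' ⟩
  ε'                           ∎
  where open ≡-Reasoning

length-decode : ∀ L a → length (decode L a) ≡ L
length-decode zero a = refl
length-decode (suc zero) a = refl
length-decode (suc (suc L)) a with fib (3 + L) ≤? a | fib (2 + L) ≤? a
... | yes _ | _ = cong (2 +_) (length-decode L (a ∸ fib (3 + L)))
... | no _ | yes _ = cong (2 +_) (length-decode L (a ∸ fib (1 + L)))
... | no _ | no _ = cong (2 +_) (length-decode L a)

∸-<-fib : ∀ L {a} m → a < m + fib (2 + L) → a ∸ m < fib (2 + L)
∸-<-fib L {a} m = m<n+o⇒m∸n<o a m {{>-nonZero (fib-pos (1 + L))}}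

rank-∷∷-decode : ∀ x y L b → rank (x ∷ y ∷ decode L b) ≡ pairWeight x y L + rank (decode L b)
rank-∷∷-decode x y L b = cong (λ n → pairWeight x y n + rank (decode L b)) (length-decode L b)

rank-decode : ∀ L {a} → a < fib (2 + L) → rank (decode L a) ≡ a
rank-decode zero {zero} _ = refl
rank-decode zero {suc _} (s≤s ())
rank-decode (suc zero) {zero} _ = refl
rank-decode (suc zero) {suc zero} _ = refl
rank-decode (suc zero) {suc (suc _)} (s≤s (s≤s ()))
rank-decode (suc (suc L)) {a} a<F₄ with fib (3 + L) ≤? a | fib (2 + L) ≤? a
... | yes F₃≤a | _ = begin
  rank (true ∷ false ∷ decode L (a ∸ F₃)) ≡⟨ rank-∷∷-decode true false L (a ∸ F₃) ⟩
  F₃ + rank (decode L (a ∸ F₃))           ≡⟨ cong (F₃ +_) (rank-decode L (∸-<-fib L F₃ a<F₄)) ⟩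
  F₃ + (a ∸ F₃)                           ≡⟨ m+[n∸m]≡n F₃≤a ⟩
  a                                       ∎
  where
  open ≡-Reasoning
  F₃ = fib (3 + L)
... | no F₃≰a | yes F₂≤a = begin
  rank (true ∷ true ∷ decode L (a ∸ F₁))  ≡⟨ rank-∷∷-decode true true L (a ∸ F₁) ⟩
  F₁ + rank (decode L (a ∸ F₁))           ≡⟨ cong (F₁ +_) (rank-decode L (∸-<-fib L F₁ a<F₁+F₂)) ⟩
  F₁ + (a ∸ F₁)                           ≡⟨ m+[n∸m]≡n (≤-trans (m≤m+n F₁ (fib L)) F₂≤a) ⟩
  a                                       ∎
  where
  open ≡-Reasoning
  F₁ = fib (1 + L)
  a<F₁+F₂ : a < F₁ + fib (2 + L)
  a<F₁+F₂ = <-≤-trans (≰⇒> F₃≰a) (≤-reflexive (+-comm (fib (2 + L)) F₁))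
... | no _ | no F₂≰a = rank-decode L (≰⇒> F₂≰a)

decode-downUp : ∀ L {a} → a < fib (2 + L) →
                DownUp (decode L a) × (fib L ≤ a → UpDown (true ∷ decode L a))
decode-downUp zero _ = tt , λ _ → tt
decode-downUp (suc zero) {zero} _ = tt , λ ()
decode-downUp (suc zero) {suc _} _ = tt , λ _ → b≤b , tt
decode-downUp (suc (suc L)) {a} a<F₄ with fib (3 + L) ≤? a | fib (2 + L) ≤? a
... | yes _ | _ = du , λ _ → b≤b , du
  where
  du : DownUp (true ∷ false ∷ decode L (a ∸ fib (3 + L)))
  du = f≤t , UpDown-false∷⁺ _ (proj₁ (decode-downUp L (∸-<-fib L (fib (3 + L)) a<F₄)))
... | no F₃≰a | yes F₂≤a = du , λ _ → b≤b , du
  where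
  F₁ = fib (1 + L)
  b<F₂ : a ∸ F₁ < fib (2 + L)
  b<F₂ = ∸-<-fib L F₁ (<-≤-trans (≰⇒> F₃≰a) (≤-reflexive (+-comm (fib (2 + L)) F₁)))
  F₀≤b : fib L ≤ a ∸ F₁
  F₀≤b = m+n≤o⇒m≤o∸n (fib L) (≤-trans (≤-reflexive (+-comm (fib L) F₁)) F₂≤a)
  du : DownUp (true ∷ true ∷ decode L (a ∸ F₁))
  du = b≤b , proj₂ (decode-downUp L b<F₂) F₀≤b
... | no _ | no F₂≰a = (b≤b , UpDown-false∷⁺ _ (proj₁ (decode-downUp L (≰⇒> F₂≰a)))) ,
                       λ F₂≤a → contradiction F₂≤a F₂≰a

rank≡0⇒AllZero : ∀ {ε} → DownUp ε → rank ε ≡ 0 → AllZero ε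
rank≡0⇒AllZero {[]} _ _ = []
rank≡0⇒AllZero {false ∷ []} _ _ = refl ∷ []
rank≡0⇒AllZero {false ∷ false ∷ r} (_ , u) r≡0 =
  refl ∷ refl ∷ rank≡0⇒AllZero (UpDown-∷⁻ false r u) r≡0
rank≡0⇒AllZero {false ∷ true ∷ _} (() , _)
rank≡0⇒AllZero {true ∷ false ∷ r} _ r≡0 =
  contradiction (m+n≡0⇒m≡0 (fib (3 + length r)) r≡0) (>⇒≢ (fib-pos (2 + length r)))
rank≡0⇒AllZero {true ∷ true ∷ r} _ r≡0 =
  contradiction (m+n≡0⇒m≡0 (fib (1 + length r)) r≡0) (>⇒≢ (fib-pos (length r)))

zeros-++-suc : ∀ j ε →
               replicate (2 * suc j) false ++ ε ≡ false ∷ false ∷ replicate (2 * j) false ++ ε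
zeros-++-suc j ε = cong (λ n → replicate n false ++ ε) (*-suc 2 j)

rank-zeros-++ : ∀ j ε → rank (replicate (2 * j) false ++ ε) ≡ rank ε
rank-zeros-++ zero ε = refl
rank-zeros-++ (suc j) ε = trans (cong rank (zeros-++-suc j ε)) (rank-zeros-++ j ε)

DownUp-zeros-++ : ∀ j {ε} → DownUp ε → DownUp (replicate (2 * j) false ++ ε)
DownUp-zeros-++ zero d = d
DownUp-zeros-++ (suc j) {ε} d =
  subst DownUp (sym (zeros-++-suc j ε)) (b≤b , UpDown-false∷⁺ _ (DownUp-zeros-++ j d))

parity-gap : ∀ {m n} → parity m ≡ parity n → m ≤ n → ∃[ j ] n ≡ 2 * j + m
parity-gap {zero} {zero} _ _ = 0 , refl
parity-gap {zero} {suc zero} () _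
parity-gap {zero} {suc (suc n)} p _ with parity-gap {zero} {n} p z≤n
... | j , e = suc j , trans (cong (2 +_) e) (cong (_+ 0) (sym (*-suc 2 j)))
parity-gap {suc zero} {suc zero} _ _ = 0 , refl
parity-gap {suc zero} {suc (suc zero)} () _
parity-gap {suc zero} {suc (suc (suc n))} p _ with parity-gap {suc zero} {suc n} p (s≤s z≤n)
... | j , e = suc j , trans (cong (2 +_) e) (cong (_+ 1) (sym (*-suc 2 j)))
parity-gap {suc (suc m)} {suc (suc n)} p (s≤s (s≤s m≤n)) with parity-gap {m} {n} p m≤n
... | j , e =
  j , trans (cong (2 +_) e) (sym (trans (+-suc (2 * j) (suc m)) (cong suc (+-suc (2 * j) m))))

same-rank⇒zeros-++ : ∀ {ε ε'} → DownUp ε → DownUp ε' → parity (length ε) ≡ parity (length ε') →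
                     length ε ≤ length ε' → rank ε ≡ rank ε' → ∃[ j ] ε' ≡ replicate (2 * j) false ++ ε
same-rank⇒zeros-++ {ε} {ε'} d d' samePar ≤len sameRank with parity-gap samePar ≤len
... | j , gap = j , rank-injective d' (DownUp-zeros-++ j d) lengths ranks
  where
  lengths : length ε' ≡ length (replicate (2 * j) false ++ ε)
  lengths = trans gap (sym (trans (length-++ (replicate (2 * j) false))
                                  (cong (_+ length ε) (length-replicate (2 * j)))))
  ranks : rank ε' ≡ rank (replicate (2 * j) false ++ ε)
  ranks = trans (sym sameRank) (sym (rank-zeros-++ j ε))

sFibNorm-injective : ∀ {ε ε'} → DownUp ε → DownUp ε' → sFibNorm ε ≡ sFibNorm ε' → Identified ε ε'
sFibNorm-injective {ε} {ε'} d d' eq with sign-cong′ signed | abs-cong signed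
  where
  signed : toSign (parity (length ε)) ◃ rank ε ≡ toSign (parity (length ε')) ◃ rank ε'
  signed = trans (sym (sFibNorm-rank d)) (trans eq (sFibNorm-rank d'))
... | inj₂ (r≡0 , r'≡0) | _ = inj₁ (rank≡0⇒AllZero d r≡0 , rank≡0⇒AllZero d' r'≡0)
... | inj₁ sameSign | sameRank with toSign-injective sameSign | ≤-total (length ε) (length ε')
...   | samePar | inj₁ ≤len = inj₂ (inj₁ (same-rank⇒zeros-++ d d' samePar ≤len sameRank))
...   | samePar | inj₂ ≥len = inj₂ (inj₂ (same-rank⇒zeros-++ d' d (sym samePar) ≥len (sym sameRank)))

length-with-parity : ∀ p a → ∃[ L ] parity L ≡ p × a < fib (2 + L)
length-with-parity 0ℙ zero = 0 , refl , s≤s z≤n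
length-with-parity 1ℙ zero = 1 , refl , s≤s z≤n
length-with-parity p (suc a) with length-with-parity p a
... | L , par , a<F₂ = 2 + L , par , +-mono-≤ (fib-pos (2 + L)) a<F₂

sFibNorm-surjective : ∀ n → ∃[ ε ] DownUp ε × sFibNorm ε ≡ n
sFibNorm-surjective n with length-with-parity (fromSign (sign n)) ∣ n ∣
... | L , par , bound = decode L ∣ n ∣ , proj₁ (decode-downUp L bound) , (begin
  sFibNorm (decode L ∣ n ∣)
    ≡⟨ sFibNorm-rank (proj₁ (decode-downUp L bound)) ⟩
  toSign (parity (length (decode L ∣ n ∣))) ◃ rank (decode L ∣ n ∣)
    ≡⟨ cong₂ (λ m r → toSign (parity m) ◃ r) (length-decode L ∣ n ∣) (rank-decode L bound) ⟩
  toSign (parity L) ◃ ∣ n ∣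
    ≡⟨ cong (λ p → toSign p ◃ ∣ n ∣) par ⟩
  toSign (fromSign (sign n)) ◃ ∣ n ∣
    ≡⟨ cong (_◃ ∣ n ∣) (toSign-inverseˡ refl) ⟩
  sign n ◃ ∣ n ∣
    ≡⟨ ◃-inverse n ⟩
  n ∎)
  where open ≡-Reasoning

proposition7p5 : (n : ℤ) →
    Σ ℕ (λ k → Σ (Ω k) (λ ε → sFibNorm (proj₁ ε) ≡ n))
    × ((k k' : ℕ) (ε : Ω k) (ε' : Ω k') →
    sFibNorm (proj₁ ε) ≡ n → sFibNorm (proj₁ ε') ≡ n →
    Identified (proj₁ ε) (proj₁ ε'))
proposition7p5 n = existence , uniqueness
  where
  existence : Σ ℕ (λ k → Σ (Ω k) (λ ε → sFibNorm (proj₁ ε) ≡ n))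
  existence with sFibNorm-surjective n
  ... | ε , d , eq = length ε , (ε , refl , d) , eq
  uniqueness : (k k' : ℕ) (ε : Ω k) (ε' : Ω k') →
               sFibNorm (proj₁ ε) ≡ n → sFibNorm (proj₁ ε') ≡ n → Identified (proj₁ ε) (proj₁ ε')
  uniqueness _ _ (_ , _ , d) (_ , _ , d') eq eq' = sFibNorm-injective d d' (trans eq (sym eq'))
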